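{- Let $d\geq 2$. If $\varphi$ is a partial $d$-edge coloring of $Q_d$ such that all colored edges lie in a subgraph of $Q_d$ isomorphic to $Q_{d-1}$, then $\varphi$ is avoidable.
   Context: $Q_d$ is the $d$-dimensional hypercube. A partial $d$-edge coloring assigns colors from $\{1,\dots,d\}$ to some subset of edges (not necessarily properly); it is avoidable if there is a proper $d$-edge coloring $f$ of $Q_d$ with colors $1,\dots,d$ such that $f(e)\neq\varphi(e)$ for every colored edge $e$. -}

module Defs where

open import Data.Nat using (ℕ)
open import Data.Bool using (Bool; true; false; not)
open import Data.Fin using (Fin)
open import Data.Vec using (Vec; lookup; updateAt)
open import Data.Maybe using (Maybe; just)
open import Data.Product using (Σ; ∃; ∃-syntax; _×_)
open import Data.Sum using (_⊎_)
open import Relation.Binary.PropositionalEquality using (_≡_; _≢_)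
open import Function.Definitions using (Injective)

Vertex : ℕ → Set
Vertex d = Vec Bool d

flipAt : ∀ {d} → Fin d → Vertex d → Vertex d
flipAt i v = updateAt v i not

Adjacent : ∀ {d} → Vertex d → Vertex d → Set
Adjacent {d} u v = ∃[ i ] (v ≡ flipAt i u)

-- An edge of Q_d, represented canonically by its lower endpoint and its direction.
record Edge (d : ℕ) : Set where
  constructor edge
  field
    lo  : Vertex d
    dir : Fin d
    low : lookup lo dir ≡ false

open Edge public

hi : ∀ {d} → Edge d → Vertex d
hi e = flipAt (dir e) (lo e)

Incident : ∀ {d} → Vertex d → Edge d → Set
Incident v e = (v ≡ lo e) ⊎ (v ≡ hi e)

-- A d-edge coloring (colors 1..d represented by Fin d) and a partial one.
EdgeColoring : ℕ → Set
EdgeColoring d = Edge d → Fin d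

PartialColoring : ℕ → Set
PartialColoring d = Edge d → Maybe (Fin d)

Proper : ∀ {d} → EdgeColoring d → Set
Proper {d} f = ∀ (e e′ : Edge d) (v : Vertex d) →
  e ≢ e′ → Incident v e → Incident v e′ → f e ≢ f e′

Avoidable : ∀ {d} → PartialColoring d → Set
Avoidable {d} φ = Σ (EdgeColoring d) λ f →
  Proper f × (∀ (e : Edge d) (c : Fin d) → φ e ≡ just c → f e ≢ c)

-- A subgraph of Q_d isomorphic to Q_{d-1} is the image of an injective graph
-- homomorphism g : Q_{d-1} → Q_d (image vertices, image edges).
-- IsEmbedding g: g injective and adjacency-preserving.
IsEmbedding : ∀ {n} → (Vertex n → Vertex (Data.Nat.suc n)) → Set
IsEmbedding {n} g = Injective _≡_ _≡_ g × (∀ (u : Vertex n) (i : Fin n) → Adjacent (g u) (g (flipAt i u)))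

InImage : ∀ {n} → (Vertex n → Vertex (Data.Nat.suc n)) → Edge (Data.Nat.suc n) → Set
InImage {n} g e = ∃[ a ] ∃[ i ] ((lo e ≡ g a) × (hi e ≡ g (flipAt i a)))

{-# OPTIONS --safe #-}
-- The image of an embedded Q_{d-1} is a facet x_k = b of Q_d: g moves each coordinate of
-- Q_{d-1} along one fixed direction of Q_d, so some direction k is never used.  Colour the
-- facets x_k = b and x_k = not b by the same proper colouring F of Q_{d-1} with d colours
-- avoiding φ, and give each edge of direction k the colour missing at its endpoints under F.
-- F exists by Galvin's argument: Q_{d-1} is bipartite and (d-1)-regular, and every edge keeps at
-- least d - 1 admissible colours; colour classes are added one at a time as kernels (stable
-- matchings) of the still-available edges in Galvin's orientation of the line graph.
module Submission where

open import Defs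
open import Level using (0ℓ)
open import Axiom.UniquenessOfIdentityProofs using (module Decidable⇒UIP)
open import Data.Bool using (Bool; true; false; not; _xor_; if_then_else_)
import Data.Bool.Properties as Bool
open import Data.Empty using (⊥-elim)
open import Data.Fin using (Fin; zero; suc; toℕ; fromℕ<; punchIn; punchOut; _≟_)
open import Data.Fin.Properties
  using (toℕ-injective; toℕ<n; toℕ-fromℕ<; any?; ¬∀⟶∃¬; injective⇒≤;
         punchInᵢ≢i; punchIn-injective; punchIn-punchOut; punchOut-cong; punchOut-injective)
open import Data.Maybe using (Maybe; just; nothing)
import Data.Maybe.Properties as Maybe
open import Data.Maybe.Properties using (just-injective)
open import Data.Nat using (ℕ; zero; suc; _+_; _∸_; _≤_; _<_; _≤?_; _<?_; z≤n; s≤s)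
import Data.Nat as ℕ
open import Data.Nat.Properties hiding (_≟_)
open import Data.Product using (∃; ∃₂; _×_; _,_; proj₁; proj₂)
open import Data.Sum using (_⊎_; inj₁; inj₂)
open import Data.Vec using ([]; _∷_; lookup; tail; replicate; insertAt; removeAt)
import Data.Vec.Properties as Vec
open import Data.Vec.Properties
  using (insertAt-lookup; insertAt-removeAt; removeAt-insertAt; tabulate∘lookup; tabulate-cong)
open import Function using (_∘_)
open import Function.Definitions using (Injective)
open import Relation.Binary.Definitions using (tri<; tri≈; tri>)
open import Relation.Binary.PropositionalEquality
open import Relation.Nullary using (¬_; Dec; yes; no; ¬?)
open import Relation.Nullary.Decidable using (map′; _×-dec_; _⊎-dec_; decidable-stable)
open import Relation.Unary using (Pred; Decidable; _⊆_)

lookup-flipAt : ∀ {n} (i : Fin n) (v : Vertex n) → lookup (flipAt i v) i ≡ not (lookup v i)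
lookup-flipAt zero    (x ∷ v) = refl
lookup-flipAt (suc i) (x ∷ v) = lookup-flipAt i v

lookup-flipAt-≢ : ∀ {n} {i j : Fin n} (v : Vertex n) → i ≢ j → lookup (flipAt i v) j ≡ lookup v j
lookup-flipAt-≢ {i = zero}  {zero}  v       i≢j = ⊥-elim (i≢j refl)
lookup-flipAt-≢ {i = zero}  {suc j} (x ∷ v) i≢j = refl
lookup-flipAt-≢ {i = suc i} {zero}  (x ∷ v) i≢j = refl
lookup-flipAt-≢ {i = suc i} {suc j} (x ∷ v) i≢j = lookup-flipAt-≢ v (i≢j ∘ cong suc)

flipAt-involutive : ∀ {n} (i : Fin n) (v : Vertex n) → flipAt i (flipAt i v) ≡ v
flipAt-involutive zero    (x ∷ v) = cong (_∷ v) (Bool.not-involutive x)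
flipAt-involutive (suc i) (x ∷ v) = cong (x ∷_) (flipAt-involutive i v)

flipAt-comm : ∀ {n} (i j : Fin n) (v : Vertex n) → flipAt i (flipAt j v) ≡ flipAt j (flipAt i v)
flipAt-comm zero    zero    v       = refl
flipAt-comm zero    (suc j) (x ∷ v) = refl
flipAt-comm (suc i) zero    (x ∷ v) = refl
flipAt-comm (suc i) (suc j) (x ∷ v) = cong (x ∷_) (flipAt-comm i j v)

flipAt-injectiveˡ : ∀ {n} {i j : Fin n} (v : Vertex n) → flipAt i v ≡ flipAt j v → i ≡ j
flipAt-injectiveˡ {i = zero}  {zero}  v       eq = refl
flipAt-injectiveˡ {i = zero}  {suc j} (x ∷ v) eq = ⊥-elim (Bool.not-¬ {x} refl (cong (λ w → lookup w zero) (sym eq)))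
flipAt-injectiveˡ {i = suc i} {zero}  (x ∷ v) eq = ⊥-elim (Bool.not-¬ {x} refl (cong (λ w → lookup w zero) eq))
flipAt-injectiveˡ {i = suc i} {suc j} (x ∷ v) eq = cong suc (flipAt-injectiveˡ v (cong tail eq))

flipAt-flipAt≡id⇒≡ : ∀ {n} {i j : Fin n} (v : Vertex n) → flipAt i (flipAt j v) ≡ v → i ≡ j
flipAt-flipAt≡id⇒≡ {i = i} {j} v eq =
  flipAt-injectiveˡ v (trans (cong (flipAt i) (sym eq)) (flipAt-involutive i (flipAt j v)))

flipAt-flipAt-moves : ∀ {n} {p q r s : Fin n} (x : Vertex n) → p ≢ q →
                      flipAt q (flipAt p x) ≡ flipAt s (flipAt r x) → p ≡ r ⊎ p ≡ s
flipAt-flipAt-moves {p = p} {q} {r} {s} x p≢q eq with p ≟ r | p ≟ s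
... | yes p≡r | _       = inj₁ p≡r
... | no _    | yes p≡s = inj₂ p≡s
... | no p≢r  | no p≢s  = ⊥-elim (Bool.not-¬ {lookup x p} refl (sym (begin
  not (lookup x p)                   ≡⟨ sym (lookup-flipAt p x) ⟩
  lookup (flipAt p x) p              ≡⟨ sym (lookup-flipAt-≢ (flipAt p x) (p≢q ∘ sym)) ⟩
  lookup (flipAt q (flipAt p x)) p   ≡⟨ cong (λ w → lookup w p) eq ⟩
  lookup (flipAt s (flipAt r x)) p   ≡⟨ lookup-flipAt-≢ (flipAt r x) (p≢s ∘ sym) ⟩
  lookup (flipAt r x) p              ≡⟨ lookup-flipAt-≢ x (p≢r ∘ sym) ⟩
  lookup x p                         ∎)))
  where open ≡-Reasoning

flipAt-closed⇒universal : ∀ {n} (P : Vertex n → Set) → (∀ v i → P v → P (flipAt i v)) →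
                          ∀ {v} → P v → ∀ w → P w
flipAt-closed⇒universal {zero}  P closed {[]}    p [] = p
flipAt-closed⇒universal {suc n} P closed {a ∷ v} p (b ∷ w) =
  flipAt-closed⇒universal (P ∘ (b ∷_)) (λ u i → closed (b ∷ u) (suc i)) (set-head a b p) w
  where
    set-head : ∀ a b → P (a ∷ v) → P (b ∷ v)
    set-head false false q = q
    set-head true  true  q = q
    set-head false true  q = closed _ zero q
    set-head true  false q = closed _ zero q

_≟ᵥ_ : ∀ {n} (u v : Vertex n) → Dec (u ≡ v)
_≟ᵥ_ = Vec.≡-dec Bool._≟_

parity : ∀ {n} → Vertex n → Bool
parity []      = false
parity (x ∷ v) = x xor parity v

parity-flipAt : ∀ {n} (i : Fin n) (v : Vertex n) → parity (flipAt i v) ≡ not (parity v)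
parity-flipAt zero    (x ∷ v) = sym (Bool.not-distribˡ-xor x (parity v))
parity-flipAt (suc i) (x ∷ v) = trans (cong (x xor_) (parity-flipAt i v)) (sym (Bool.not-distribʳ-xor x (parity v)))

any-vertex? : ∀ {n} {P : Vertex n → Set} → (∀ v → Dec (P v)) → Dec (∃ P)
any-vertex? {zero} P? = map′ ([] ,_) (λ { ([] , p) → p }) (P? [])
any-vertex? {suc n} {P} P? = map′ join split (any-vertex? (P? ∘ (true ∷_)) ⊎-dec any-vertex? (P? ∘ (false ∷_)))
  where
    join : ∃ (P ∘ (true ∷_)) ⊎ ∃ (P ∘ (false ∷_)) → ∃ P
    join (inj₁ (v , p)) = true ∷ v , p
    join (inj₂ (v , p)) = false ∷ v , p
    split : ∃ P → ∃ (P ∘ (true ∷_)) ⊎ ∃ (P ∘ (false ∷_))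
    split (true ∷ v , p)  = inj₁ (v , p)
    split (false ∷ v , p) = inj₂ (v , p)

sum-vertices : ∀ {n} → (Vertex n → ℕ) → ℕ
sum-vertices {zero}  f = f []
sum-vertices {suc n} f = sum-vertices (f ∘ (true ∷_)) + sum-vertices (f ∘ (false ∷_))

sum-vertices-mono-≤ : ∀ {n} {f g : Vertex n → ℕ} → (∀ v → f v ≤ g v) → sum-vertices f ≤ sum-vertices g
sum-vertices-mono-≤ {zero}  f≤g = f≤g []
sum-vertices-mono-≤ {suc n} f≤g =
  +-mono-≤ (sum-vertices-mono-≤ (f≤g ∘ (true ∷_))) (sum-vertices-mono-≤ (f≤g ∘ (false ∷_)))

sum-vertices-mono-< : ∀ {n} {f g : Vertex n → ℕ} → (∀ v → f v ≤ g v) → ∀ u → f u < g u →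
                      sum-vertices f < sum-vertices g
sum-vertices-mono-< {zero}  f≤g []      fu<gu = fu<gu
sum-vertices-mono-< {suc n} f≤g (true ∷ u)  fu<gu =
  +-mono-<-≤ (sum-vertices-mono-< (f≤g ∘ (true ∷_)) u fu<gu) (sum-vertices-mono-≤ (f≤g ∘ (false ∷_)))
sum-vertices-mono-< {suc n} f≤g (false ∷ u) fu<gu =
  +-mono-≤-< (sum-vertices-mono-≤ (f≤g ∘ (true ∷_))) (sum-vertices-mono-< (f≤g ∘ (false ∷_)) u fu<gu)

count : ∀ {n} {P : Pred (Fin n) 0ℓ} → Decidable P → ℕ
count {zero}  P? = 0
count {suc n} P? with P? zero
... | yes _ = suc (count (P? ∘ suc))
... | no  _ = count (P? ∘ suc)

count-mono-≤ : ∀ {n} {P Q : Pred (Fin n) 0ℓ} (P? : Decidable P) (Q? : Decidable Q) → P ⊆ Q → count P? ≤ count Q?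
count-mono-≤ {zero}  P? Q? P⊆Q = z≤n
count-mono-≤ {suc n} P? Q? P⊆Q with P? zero | Q? zero
... | yes p | yes _ = s≤s (count-mono-≤ (P? ∘ suc) (Q? ∘ suc) P⊆Q)
... | yes p | no ¬q = ⊥-elim (¬q (P⊆Q p))
... | no  _ | yes _ = m≤n⇒m≤1+n (count-mono-≤ (P? ∘ suc) (Q? ∘ suc) P⊆Q)
... | no  _ | no  _ = count-mono-≤ (P? ∘ suc) (Q? ∘ suc) P⊆Q

count-mono-< : ∀ {n} {P Q : Pred (Fin n) 0ℓ} (P? : Decidable P) (Q? : Decidable Q) → P ⊆ Q →
               ∀ k → ¬ P k → Q k → count P? < count Q?
count-mono-< P? Q? P⊆Q zero ¬pk qk with P? zero | Q? zero
... | yes p | _     = ⊥-elim (¬pk p)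
... | no  _ | yes _ = s≤s (count-mono-≤ (P? ∘ suc) (Q? ∘ suc) P⊆Q)
... | no  _ | no ¬q = ⊥-elim (¬q qk)
count-mono-< P? Q? P⊆Q (suc k) ¬pk qk with P? zero | Q? zero
... | yes p | yes _ = s≤s (count-mono-< (P? ∘ suc) (Q? ∘ suc) P⊆Q k ¬pk qk)
... | yes p | no ¬q = ⊥-elim (¬q (P⊆Q p))
... | no  _ | yes _ = m≤n⇒m≤1+n (count-mono-< (P? ∘ suc) (Q? ∘ suc) P⊆Q k ¬pk qk)
... | no  _ | no  _ = count-mono-< (P? ∘ suc) (Q? ∘ suc) P⊆Q k ¬pk qk

count≤n : ∀ {n} {P : Pred (Fin n) 0ℓ} (P? : Decidable P) → count P? ≤ n
count≤n {zero}  P? = z≤n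
count≤n {suc n} P? with P? zero
... | yes _ = s≤s (count≤n (P? ∘ suc))
... | no  _ = m≤n⇒m≤1+n (count≤n (P? ∘ suc))

count<n : ∀ {n} {P : Pred (Fin n) 0ℓ} (P? : Decidable P) → ∀ k → ¬ P k → count P? < n
count<n {suc n} P? zero ¬pk with P? zero
... | yes p = ⊥-elim (¬pk p)
... | no  _ = s≤s (count≤n (P? ∘ suc))
count<n {suc n} P? (suc k) ¬pk with P? zero
... | yes _ = s≤s (count<n (P? ∘ suc) k ¬pk)
... | no  _ = m≤n⇒m≤1+n (count<n (P? ∘ suc) k ¬pk)

missing-value : ∀ {n} (h : Fin n → Fin (suc n)) → ∃ λ c → ∀ i → h i ≢ c
missing-value {n} h with ¬∀⟶∃¬ (suc n) (λ c → ∃ λ i → h i ≡ c) (λ c → any? (λ i → h i ≟ c)) ¬surjective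
  where
    ¬surjective : ¬ (∀ c → ∃ λ i → h i ≡ c)
    ¬surjective surj = 1+n≰n (injective⇒≤ section-injective)
      where
        section-injective : Injective _≡_ _≡_ (proj₁ ∘ surj)
        section-injective {c} {c′} eq =
          trans (sym (proj₂ (surj c))) (trans (cong h eq) (proj₂ (surj c′)))
... | c , c∉image = c , λ i hi≡c → c∉image (i , hi≡c)

-- An edge of Q_n is seen from each endpoint v as a direction i, so sets and colourings of edges
-- are given on pairs (v, i) and must not distinguish (v, i) from (flipAt i v, i).
EdgeSet : ℕ → Set₁
EdgeSet n = Vertex n → Fin n → Set

FlipClosed : ∀ {n} → EdgeSet n → Set
FlipClosed S = ∀ v i → S v i → S (flipAt i v) i

FlipInvariant : ∀ {n} {A : Set} → (Vertex n → Fin n → A) → Set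
FlipInvariant C = ∀ v i → C (flipAt i v) i ≡ C v i

record LocallyProper {n} {A : Set} (C : Vertex n → Fin n → A) : Set where
  field
    flipAt-invariant : FlipInvariant C
    injective        : ∀ v → Injective _≡_ _≡_ (C v)

evenEnd : ∀ {n} → Vertex n → Fin n → Vertex n
evenEnd v i = if parity v then v else flipAt i v

oddEnd : ∀ {n} → Vertex n → Fin n → Vertex n
oddEnd v i = flipAt i (evenEnd v i)

module _ {n} (v : Vertex n) (i : Fin n) where

  parity-evenEnd : parity (evenEnd v i) ≡ true
  parity-evenEnd with parity v in eq
  ... | true  = eq
  ... | false = trans (parity-flipAt i v) (cong not eq)

  parity-oddEnd : parity (oddEnd v i) ≡ false
  parity-oddEnd = trans (parity-flipAt i (evenEnd v i)) (cong not parity-evenEnd)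

  evenEnd-flipAt : evenEnd (flipAt i v) i ≡ evenEnd v i
  evenEnd-flipAt rewrite parity-flipAt i v with parity v
  ... | true  = flipAt-involutive i v
  ... | false = refl

  evenEnd-even : parity v ≡ true → evenEnd v i ≡ v
  evenEnd-even eq rewrite eq = refl

  evenEnd-odd : parity v ≡ false → evenEnd v i ≡ flipAt i v
  evenEnd-odd eq rewrite eq = refl

module _ {n} {S : EdgeSet n} (S-flipAt : FlipClosed S) (v : Vertex n) (i : Fin n) where

  FlipClosed⁻ : S (flipAt i v) i → S v i
  FlipClosed⁻ s = subst (λ u → S u i) (flipAt-involutive i v) (S-flipAt (flipAt i v) i s)

  FlipClosed-evenEnd : S v i → S (evenEnd v i) i
  FlipClosed-evenEnd s with parity v
  ... | true  = s
  ... | false = S-flipAt v i s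

  FlipClosed-evenEnd⁻ : S (evenEnd v i) i → S v i
  FlipClosed-evenEnd⁻ s with parity v
  ... | true  = s
  ... | false = FlipClosed⁻ s

-- Galvin's orientation of the line graph of Q_n: the edge (v, i) points to the edges of smaller
-- direction at its even end and to those of larger direction at its odd end.
data Out {n} (X : EdgeSet n) (v : Vertex n) (i : Fin n) (j : Fin n) : Set where
  at-even : toℕ j < toℕ i → X (evenEnd v i) j → Out X v i j
  at-odd  : toℕ i < toℕ j → X (oddEnd v i) j  → Out X v i j

Out? : ∀ {n} {X : EdgeSet n} → (∀ v j → Dec (X v j)) → ∀ v i j → Dec (Out X v i j)
Out? {X = X} X? v i j = map′ join split
  ((toℕ j <? toℕ i ×-dec X? (evenEnd v i) j) ⊎-dec (toℕ i <? toℕ j ×-dec X? (oddEnd v i) j))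
  where
    join : (toℕ j < toℕ i × X (evenEnd v i) j) ⊎ (toℕ i < toℕ j × X (oddEnd v i) j) → Out X v i j
    join (inj₁ (j<i , x)) = at-even j<i x
    join (inj₂ (i<j , x)) = at-odd i<j x
    split : Out X v i j → (toℕ j < toℕ i × X (evenEnd v i) j) ⊎ (toℕ i < toℕ j × X (oddEnd v i) j)
    split (at-even j<i x) = inj₁ (j<i , x)
    split (at-odd i<j x)  = inj₂ (i<j , x)

Out-mono : ∀ {n} {X Y : EdgeSet n} → (∀ {u j} → X u j → Y u j) → ∀ {v i j} → Out X v i j → Out Y v i j
Out-mono X⊆Y (at-even j<i x) = at-even j<i (X⊆Y x)
Out-mono X⊆Y (at-odd  i<j x) = at-odd  i<j (X⊆Y x)

Out-disjoint : ∀ {n} {X Y : EdgeSet n} → (∀ {u j} → X u j → ¬ Y u j) →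
               ∀ {v i j} → Out X v i j → ¬ Out Y v i j
Out-disjoint X∩Y=∅ (at-even _   x) (at-even _   y) = X∩Y=∅ x y
Out-disjoint X∩Y=∅ (at-even j<i _) (at-odd  i<j _) = <-asym j<i i<j
Out-disjoint X∩Y=∅ (at-odd  i<j _) (at-even j<i _) = <-asym j<i i<j
Out-disjoint X∩Y=∅ (at-odd  _   x) (at-odd  _   y) = X∩Y=∅ x y

Out-irrefl : ∀ {n} {X : EdgeSet n} {v i} → ¬ Out X v i i
Out-irrefl (at-even i<i _) = <-irrefl refl i<i
Out-irrefl (at-odd  i<i _) = <-irrefl refl i<i

record Kernel {n} (S : EdgeSet n) : Set₁ where
  field
    K          : EdgeSet n
    K?         : ∀ v j → Dec (K v j)
    K⊆S        : ∀ {v j} → K v j → S v j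
    K-flipAt   : FlipClosed K
    K-matching : ∀ {v j j′} → K v j → K v j′ → j ≡ j′
    K-absorbs  : ∀ {v i} → S v i → ¬ K v i → ∃ (Out K v i)

-- Gale–Shapley: each even vertex u proposes along the S-edge of direction p u, moving up when
-- rejected; an odd vertex keeps only the proposal of largest direction.
module DeferredAcceptance {n} {S : EdgeSet n} (S? : ∀ v j → Dec (S v j)) (S-flipAt : FlipClosed S) where

  Pointers : Set
  Pointers = Vertex n → ℕ

  Proposes : Pointers → EdgeSet n
  Proposes p u j = parity u ≡ true × p u ≡ toℕ j × S u j

  Proposes? : ∀ p u j → Dec (Proposes p u j)
  Proposes? p u j = (parity u Bool.≟ true) ×-dec (p u ℕ.≟ toℕ j) ×-dec S? u j

  Proposes-unique : ∀ p {u j j′} → Proposes p u j → Proposes p u j′ → j ≡ j′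
  Proposes-unique p (_ , p≡j , _) (_ , p≡j′ , _) = toℕ-injective (trans (sym p≡j) p≡j′)

  Rejected : Pointers → Vertex n → Fin n → Set
  Rejected p u j = ∃ λ j′ → toℕ j < toℕ j′ × Proposes p (flipAt j′ (flipAt j u)) j′

  RejectedBelowPointer : Pointers → Set
  RejectedBelowPointer p = ∀ {u j} → parity u ≡ true → toℕ j < p u → S u j → Rejected p u j

  record Stable (p : Pointers) : Set where
    field
      supported  : ∀ {u j} → parity u ≡ true → p u ≡ toℕ j → S u j
      monogamous : ∀ {w j j′} → Proposes p (flipAt j w) j → Proposes p (flipAt j′ w) j′ → j ≡ j′
      rejected   : RejectedBelowPointer p

  bump : Vertex n → Pointers → Pointers
  bump u p v with v ≟ᵥ u
  ... | yes _ = suc (p v)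
  ... | no  _ = p v

  bump-≡ : ∀ u p → bump u p u ≡ suc (p u)
  bump-≡ u p with u ≟ᵥ u
  ... | yes _   = refl
  ... | no  u≢u = ⊥-elim (u≢u refl)

  bump-≢ : ∀ {u v} p → v ≢ u → bump u p v ≡ p v
  bump-≢ {u} {v} p v≢u with v ≟ᵥ u
  ... | yes v≡u = ⊥-elim (v≢u v≡u)
  ... | no  _   = refl

  bump-≥ : ∀ u p v → p v ≤ bump u p v
  bump-≥ u p v with v ≟ᵥ u
  ... | yes _ = n≤1+n (p v)
  ... | no  _ = ≤-refl

  Proposes-bump : ∀ {u x j} p → x ≢ u → Proposes p x j → Proposes (bump u p) x j
  Proposes-bump p x≢u (even , p≡j , s) = even , trans (bump-≢ p x≢u) p≡j , s

  potential : Pointers → ℕ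
  potential p = sum-vertices (λ v → n ∸ p v)

  potential-bump : ∀ {u j} p → p u ≡ toℕ j → potential (bump u p) < potential p
  potential-bump {u} {j} p p≡j = sum-vertices-mono-< (λ v → ∸-monoʳ-≤ n (bump-≥ u p v)) u (begin-strict
    n ∸ bump u p u  ≡⟨ cong (n ∸_) (bump-≡ u p) ⟩
    n ∸ suc (p u)   <⟨ ∸-monoʳ-< (n<1+n (p u)) (subst (_< n) (sym p≡j) (toℕ<n j)) ⟩
    n ∸ p u         ∎)
    where open ≤-Reasoning

  -- A rejected edge stays rejected when a vertex whose own proposal is rejected advances
  -- its pointer: the rejecting proposal does not come from that vertex.
  Rejected-bump : ∀ {u₀ u j} p → (∀ {j₀} → Proposes p u₀ j₀ → Rejected p u₀ j₀) →
                  Rejected p u j → Rejected (bump u₀ p) u j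
  Rejected-bump {u₀} {u} {j} p u₀-rejected (j′ , j<j′ , pr) with flipAt j′ (flipAt j u) ≟ᵥ u₀
  ... | no  x≢u₀ = j′ , j<j′ , Proposes-bump p x≢u₀ pr
  ... | yes x≡u₀ with u₀-rejected (subst (λ x → Proposes p x j′) x≡u₀ pr)
  ...   | j″ , j′<j″ , pr′ = j″ , <-trans j<j′ j′<j″ , Proposes-bump p y≢u₀ pr″
    where
      same-odd : flipAt j′ u₀ ≡ flipAt j u
      same-odd = trans (cong (flipAt j′) (sym x≡u₀)) (flipAt-involutive j′ (flipAt j u))
      pr″ : Proposes p (flipAt j″ (flipAt j u)) j″
      pr″ = subst (λ x → Proposes p (flipAt j″ x) j″) same-odd pr′
      y≢u₀ : flipAt j″ (flipAt j u) ≢ u₀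
      y≢u₀ y≡u₀ = <⇒≢ j′<j″ (cong toℕ (Proposes-unique p
        (subst (λ x → Proposes p x j′) x≡u₀ pr) (subst (λ x → Proposes p x j″) y≡u₀ pr″)))

  RejectedBelowPointer-bump : ∀ {u₀} p → (∀ {j₀} → Proposes p u₀ j₀ → Rejected p u₀ j₀) →
                              RejectedBelowPointer p → RejectedBelowPointer (bump u₀ p)
  RejectedBelowPointer-bump {u₀} p u₀-rejected rej {u} {j} even j<p′ s with u ≟ᵥ u₀
  ... | no  u≢u₀ = Rejected-bump p u₀-rejected (rej even j<p′ s)
  ... | yes refl with m<1+n⇒m<n∨m≡n j<p′
  ...   | inj₁ j<p = Rejected-bump p u₀-rejected (rej even j<p s)
  ...   | inj₂ j≡p = Rejected-bump p u₀-rejected (u₀-rejected (even , sym j≡p , s))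

  Unsupported : Pointers → Set
  Unsupported p = ∃ λ u → ∃ λ j → parity u ≡ true × p u ≡ toℕ j × ¬ S u j

  Collision : Pointers → Set
  Collision p = ∃ λ w → ∃ λ j → ∃ λ j′ →
    toℕ j < toℕ j′ × Proposes p (flipAt j w) j × Proposes p (flipAt j′ w) j′

  unsupported? : ∀ p → Dec (Unsupported p)
  unsupported? p = any-vertex? λ u → any? λ j → (parity u Bool.≟ true) ×-dec (p u ℕ.≟ toℕ j) ×-dec ¬? (S? u j)

  collision? : ∀ p → Dec (Collision p)
  collision? p = any-vertex? λ w → any? λ j → any? λ j′ →
    (toℕ j <? toℕ j′) ×-dec Proposes? p (flipAt j w) j ×-dec Proposes? p (flipAt j′ w) j′

  run : (fuel : ℕ) (p : Pointers) → RejectedBelowPointer p → potential p < fuel → ∃ Stable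
  run zero       p rej ()
  run (suc fuel) p rej bound with unsupported? p
  ... | yes (u , j , _ , p≡j , ¬s) =
    run fuel (bump u p) (RejectedBelowPointer-bump p no-proposal rej) (≤-trans (potential-bump p p≡j) (≤-pred bound))
    where
      no-proposal : ∀ {j₀} → Proposes p u j₀ → Rejected p u j₀
      no-proposal (_ , p≡j₀ , s) = ⊥-elim (¬s (subst (S u) (toℕ-injective (trans (sym p≡j₀) p≡j)) s))
  ... | no ¬unsupported with collision? p
  ...   | yes (w , j , j′ , j<j′ , pr , pr′) =
    run fuel (bump (flipAt j w) p) (RejectedBelowPointer-bump p outbid rej)
        (≤-trans (potential-bump p (proj₁ (proj₂ pr))) (≤-pred bound))
    where
      outbid : ∀ {j₀} → Proposes p (flipAt j w) j₀ → Rejected p (flipAt j w) j₀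
      outbid pr₀ with Proposes-unique p pr pr₀
      ... | refl = j′ , j<j′ , subst (λ x → Proposes p (flipAt j′ x) j′) (sym (flipAt-involutive j w)) pr′
  ...   | no ¬collision = p , record
    { supported  = λ {u} {j} even p≡j → decidable-stable (S? u j) (λ ¬s → ¬unsupported (u , j , even , p≡j , ¬s))
    ; monogamous = monogamous
    ; rejected   = rej
    }
    where
      monogamous : ∀ {w j j′} → Proposes p (flipAt j w) j → Proposes p (flipAt j′ w) j′ → j ≡ j′
      monogamous {w} {j} {j′} pr pr′ with <-cmp (toℕ j) (toℕ j′)
      ... | tri< j<j′ _ _ = ⊥-elim (¬collision (w , j , j′ , j<j′ , pr , pr′))
      ... | tri≈ _ j≡j′ _ = toℕ-injective j≡j′
      ... | tri> _ _ j′<j = ⊥-elim (¬collision (w , j′ , j , j′<j , pr′ , pr))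

  stable : ∃ Stable
  stable = run (suc (potential (λ _ → 0))) (λ _ → 0) (λ _ j<0 _ → ⊥-elim (n≮0 j<0)) ≤-refl

  abstract
    kernel : Kernel S
    kernel = record
      { K          = K
      ; K?         = λ v j → Proposes? p (evenEnd v j) j
      ; K⊆S        = λ {v} {j} (_ , _ , s) → FlipClosed-evenEnd⁻ S-flipAt v j s
      ; K-flipAt   = λ v j → subst (λ u → Proposes p u j) (sym (evenEnd-flipAt v j))
      ; K-matching = λ {v} → matching {v}
      ; K-absorbs  = λ {v} → absorbs {v}
      }
      where
        p : Pointers
        p = proj₁ stable
        open Stable (proj₂ stable)

        K : EdgeSet n
        K v j = Proposes p (evenEnd v j) j

        matching : ∀ {v j j′} → K v j → K v j′ → j ≡ j′
        matching {v} k k′ with parity v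
        ... | true  = Proposes-unique p k k′
        ... | false = monogamous k k′

        absorbs : ∀ {v i} → S v i → ¬ K v i → ∃ (Out K v i)
        absorbs {v} {i} s ¬k with <-cmp (p (evenEnd v i)) (toℕ i)
        ... | tri< p<i _ _ = j , at-even (subst (_< toℕ i) (sym j≡p) p<i)
            (subst (λ x → Proposes p x j) (sym (evenEnd-even u j even)) (even , sym j≡p , supported even (sym j≡p)))
          where
            u : Vertex n
            u = evenEnd v i
            even : parity u ≡ true
            even = parity-evenEnd v i
            j : Fin n
            j = fromℕ< (<-trans p<i (toℕ<n i))
            j≡p : toℕ j ≡ p u
            j≡p = toℕ-fromℕ< (<-trans p<i (toℕ<n i))
        ... | tri≈ _ p≡i _ = ⊥-elim (¬k (parity-evenEnd v i , p≡i , FlipClosed-evenEnd S-flipAt v i s))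
        ... | tri> _ _ i<p with rejected (parity-evenEnd v i) i<p (FlipClosed-evenEnd S-flipAt v i s)
        ...   | j′ , i<j′ , pr = j′ , at-odd i<j′
            (subst (λ x → Proposes p x j′) (sym (evenEnd-odd (oddEnd v i) j′ (parity-oddEnd v i))) pr)

module ListColouring {n} (Φ : Vertex n → Fin n → Maybe (Fin (suc n))) (Φ-flipAt : FlipInvariant Φ) where

  Colour : Set
  Colour = Fin (suc n)

  Partial : Set
  Partial = Vertex n → Fin n → Maybe Colour

  Uncoloured : Partial → EdgeSet n
  Uncoloured G v j = G v j ≡ nothing

  uncoloured? : ∀ G v j → Dec (Uncoloured G v j)
  uncoloured? G v j = Maybe.≡-dec _≟_ (G v j) nothing

  outdegree : Partial → Vertex n → Fin n → ℕ
  outdegree G v i = count (Out? (uncoloured? G) v i)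

  pending : ℕ → Maybe Colour → ℕ
  pending α nothing = 0
  pending α (just c) with α ≤? toℕ c
  ... | yes _ = 1
  ... | no  _ = 0

  pending≤1 : ∀ α m → pending α m ≤ 1
  pending≤1 α nothing = z≤n
  pending≤1 α (just c) with α ≤? toℕ c
  ... | yes _ = s≤s z≤n
  ... | no  _ = z≤n

  pending-suc : ∀ α m → pending (suc α) m ≤ pending α m
  pending-suc α nothing = z≤n
  pending-suc α (just c) with suc α ≤? toℕ c | α ≤? toℕ c
  ... | yes _   | yes _  = ≤-refl
  ... | yes α<c | no α≰c = ⊥-elim (α≰c (<⇒≤ α<c))
  ... | no  _   | _      = z≤n

  pending-drop : ∀ α c → toℕ c ≡ α → pending (suc α) (just c) < pending α (just c)
  pending-drop α c c≡α with suc α ≤? toℕ c | α ≤? toℕ c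
  ... | yes α<c | _      = ⊥-elim (<-irrefl (sym c≡α) α<c)
  ... | no  _   | yes _  = s≤s z≤n
  ... | no  _   | no α≰c = ⊥-elim (α≰c (≤-reflexive (sym c≡α)))

  -- The budget: an uncoloured edge has more admissible colours left (at least α and not
  -- forbidden) than uncoloured out-neighbours.
  record Stage (α : ℕ) (G : Partial) : Set where
    field
      flipAt-invariant : FlipInvariant G
      injective        : ∀ {v j j′ c} → G v j ≡ just c → G v j′ ≡ just c → j ≡ j′
      avoids           : ∀ {v j c} → G v j ≡ just c → Φ v j ≢ just c
      below            : ∀ {v j c} → G v j ≡ just c → toℕ c < α
      budget           : ∀ {v j} → G v j ≡ nothing → outdegree G v j + pending α (Φ v j) + α ≤ n

  open Stage

  none : Partial
  none _ _ = nothing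

  stage₀ : Stage 0 none
  stage₀ = record
    { flipAt-invariant = λ _ _ → refl
    ; injective        = λ ()
    ; avoids           = λ ()
    ; below            = λ ()
    ; budget           = λ {v} {j} _ → begin
        outdegree none v j + pending 0 (Φ v j) + 0 ≡⟨ +-identityʳ _ ⟩
        outdegree none v j + pending 0 (Φ v j)     ≤⟨ +-monoʳ-≤ _ (pending≤1 0 (Φ v j)) ⟩
        outdegree none v j + 1                     ≡⟨ +-comm _ 1 ⟩
        suc (outdegree none v j)                   ≤⟨ count<n (Out? (uncoloured? none) v j) j
                                                               (Out-irrefl {X = Uncoloured none} {v}) ⟩
        n                                          ∎
    }
    where open ≤-Reasoning

  module Step {α : ℕ} (α<1+n : α < suc n) {G : Partial} (I : Stage α G) where

    α′ : Colour
    α′ = fromℕ< α<1+n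

    α′≡α : toℕ α′ ≡ α
    α′≡α = toℕ-fromℕ< α<1+n

    Available : EdgeSet n
    Available v j = G v j ≡ nothing × Φ v j ≢ just α′

    Available? : ∀ v j → Dec (Available v j)
    Available? v j = uncoloured? G v j ×-dec ¬? (Maybe.≡-dec _≟_ (Φ v j) (just α′))

    Available-flipAt : FlipClosed Available
    Available-flipAt v j (unc , ¬α) =
      trans (flipAt-invariant I v j) unc , ¬α ∘ trans (sym (Φ-flipAt v j))

    open Kernel (DeferredAcceptance.kernel Available? Available-flipAt)

    G′ : Partial
    G′ v j with K? v j
    ... | yes _ = just α′
    ... | no  _ = G v j

    G′-uncoloured : ∀ {v j} → G′ v j ≡ nothing → G v j ≡ nothing × ¬ K v j
    G′-uncoloured {v} {j} eq with K? v j
    ... | no ¬k = eq , ¬k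

    Out-G′⊆Out-G : ∀ {v i j} → Out (Uncoloured G′) v i j → Out (Uncoloured G) v i j
    Out-G′⊆Out-G = Out-mono (λ {u} {j} unc → proj₁ (G′-uncoloured {u} {j} unc))

    outdegree-mono-≤ : ∀ v i → outdegree G′ v i ≤ outdegree G v i
    outdegree-mono-≤ v i = count-mono-≤ (Out? (uncoloured? G′) v i) (Out? (uncoloured? G) v i) Out-G′⊆Out-G

    -- A kernel edge absorbing (v, i) is coloured α now but was uncoloured before.
    outdegree-mono-< : ∀ {v i} → Available v i → ¬ K v i → outdegree G′ v i < outdegree G v i
    outdegree-mono-< {v} {i} s ¬k with K-absorbs s ¬k
    ... | j , out = count-mono-< (Out? (uncoloured? G′) v i) (Out? (uncoloured? G) v i) Out-G′⊆Out-G j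
      (Out-disjoint (λ {u} {j} k unc → proj₂ (G′-uncoloured {u} {j} unc) k) out)
      (Out-mono (λ {u} {j} k → proj₁ (K⊆S {u} {j} k)) out)

    budget-drop : ∀ {v j} → G v j ≡ nothing → ¬ K v j →
                  outdegree G′ v j + pending (suc α) (Φ v j) < outdegree G v j + pending α (Φ v j)
    budget-drop {v} {j} unc ¬k with Maybe.≡-dec _≟_ (Φ v j) (just α′)
    ... | yes Φ≡α′ rewrite Φ≡α′ =
      +-mono-≤-< (outdegree-mono-≤ v j) (pending-drop α α′ α′≡α)
    ... | no  Φ≢α′ =
      +-mono-<-≤ (outdegree-mono-< (unc , Φ≢α′) ¬k) (pending-suc α (Φ v j))

    G-below-α′ : ∀ {v j} → ¬ (G v j ≡ just α′)
    G-below-α′ eq = <-irrefl α′≡α (below I eq)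

    stage′ : Stage (suc α) G′
    stage′ .flipAt-invariant v j with K? (flipAt j v) j | K? v j
    ... | yes _ | yes _ = refl
    ... | yes k | no ¬k = ⊥-elim (¬k (FlipClosed⁻ K-flipAt v j k))
    ... | no ¬k | yes k = ⊥-elim (¬k (K-flipAt v j k))
    ... | no _  | no _  = flipAt-invariant I v j
    stage′ .injective {v} {j} {j′} eq eq′ with K? v j | K? v j′
    ... | yes k | yes k′ = K-matching {v} k k′
    ... | yes _ | no _   = ⊥-elim (G-below-α′ (subst (λ c → G v j′ ≡ just c) (sym (just-injective eq)) eq′))
    ... | no _  | yes _  = ⊥-elim (G-below-α′ (subst (λ c → G v j ≡ just c) (sym (just-injective eq′)) eq))
    ... | no _  | no _   = injective I eq eq′
    stage′ .avoids {v} {j} eq with K? v j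
    ... | yes k = subst (λ c → Φ v j ≢ just c) (just-injective eq) (proj₂ (K⊆S k))
    ... | no _  = avoids I eq
    stage′ .below {v} {j} eq with K? v j
    ... | yes _ = subst (λ c → toℕ c < suc α) (just-injective eq) (s≤s (≤-reflexive α′≡α))
    ... | no _  = m<n⇒m<1+n (below I eq)
    stage′ .budget {v} {j} eq with G′-uncoloured eq
    ... | unc , ¬k = begin
      outdegree G′ v j + pending (suc α) (Φ v j) + suc α   ≡⟨ +-suc _ α ⟩
      suc (outdegree G′ v j + pending (suc α) (Φ v j)) + α ≤⟨ +-monoˡ-≤ α (budget-drop unc ¬k) ⟩
      outdegree G v j + pending α (Φ v j) + α              ≤⟨ budget I unc ⟩
      n                                                    ∎
      where open ≤-Reasoning

  stage : ∀ α → α ≤ suc n → ∃ (Stage α)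
  stage zero    _     = _ , stage₀
  stage (suc α) α<1+n with stage α (<⇒≤ α<1+n)
  ... | G , I = Step.G′ α<1+n I , Step.stage′ α<1+n I

  abstract
    colouring : ∃ λ (F : Vertex n → Fin n → Colour) → LocallyProper F × (∀ v j → Φ v j ≢ just (F v j))
    colouring = F , record { flipAt-invariant = F-flipAt ; injective = F-injective } , F-avoids
      where
        G : Partial
        G = proj₁ (stage (suc n) ≤-refl)
        I : Stage (suc n) G
        I = proj₂ (stage (suc n) ≤-refl)

        coloured : ∀ v j → ∃ λ c → G v j ≡ just c
        coloured v j with G v j in eq
        ... | just c  = c , refl
        ... | nothing = ⊥-elim (1+n≰n (≤-trans (m≤n+m (suc n) _) (budget I {v} {j} eq)))

        F : Vertex n → Fin n → Colour
        F v j = proj₁ (coloured v j)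

        F-flipAt : FlipInvariant F
        F-flipAt v j = just-injective (begin
          just (F (flipAt j v) j) ≡⟨ sym (proj₂ (coloured (flipAt j v) j)) ⟩
          G (flipAt j v) j        ≡⟨ flipAt-invariant I v j ⟩
          G v j                   ≡⟨ proj₂ (coloured v j) ⟩
          just (F v j)            ∎)
          where open ≡-Reasoning

        F-injective : ∀ v → Injective _≡_ _≡_ (F v)
        F-injective v {j} {j′} F≡ =
          injective I {v} (proj₂ (coloured v j)) (trans (proj₂ (coloured v j′)) (cong just (sym F≡)))

        F-avoids : ∀ v j → Φ v j ≢ just (F v j)
        F-avoids v j = avoids I {v} (proj₂ (coloured v j))

module _ {n} {g : Vertex n → Vertex (suc n)} (g-embedding : IsEmbedding g) where

  g-injective : Injective _≡_ _≡_ g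
  g-injective = proj₁ g-embedding

  direction : Vertex n → Fin n → Fin (suc n)
  direction v i = proj₁ (proj₂ g-embedding v i)

  g-flipAt : ∀ v i → g (flipAt i v) ≡ flipAt (direction v i) (g v)
  g-flipAt v i = proj₂ (proj₂ g-embedding v i)

  direction-flipAt : ∀ v i → direction (flipAt i v) i ≡ direction v i
  direction-flipAt v i = flipAt-flipAt≡id⇒≡ (g v) (begin
    flipAt (direction (flipAt i v) i) (flipAt (direction v i) (g v)) ≡⟨ cong (flipAt _) (sym (g-flipAt v i)) ⟩
    flipAt (direction (flipAt i v) i) (g (flipAt i v))                ≡⟨ sym (g-flipAt (flipAt i v) i) ⟩
    g (flipAt i (flipAt i v))                                         ≡⟨ cong g (flipAt-involutive i v) ⟩
    g v                                                               ∎)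
    where open ≡-Reasoning

  -- The two ways around the square spanned by directions i and j must use the same two
  -- directions of Q_{n+1}; matching p with r would make g identify flipAt i v and flipAt j v.
  direction-flipAt-≢ : ∀ v {i j} → i ≢ j → direction (flipAt j v) i ≡ direction v i
  direction-flipAt-≢ v {i} {j} i≢j with flipAt-flipAt-moves (g v) p≢q square
    where
      p q : Fin (suc n)
      p = direction v i
      q = direction (flipAt i v) j
      square : flipAt q (flipAt p (g v)) ≡ flipAt (direction (flipAt j v) i) (flipAt (direction v j) (g v))
      square = begin
        flipAt q (flipAt p (g v))   ≡⟨ cong (flipAt q) (sym (g-flipAt v i)) ⟩
        flipAt q (g (flipAt i v))   ≡⟨ sym (g-flipAt (flipAt i v) j) ⟩
        g (flipAt j (flipAt i v))   ≡⟨ cong g (flipAt-comm j i v) ⟩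
        g (flipAt i (flipAt j v))   ≡⟨ g-flipAt (flipAt j v) i ⟩
        flipAt _ (g (flipAt j v))   ≡⟨ cong (flipAt _) (g-flipAt v j) ⟩
        flipAt _ (flipAt (direction v j) (g v)) ∎
        where open ≡-Reasoning
      p≢q : p ≢ q
      p≢q p≡q = i≢j (sym (flipAt-flipAt≡id⇒≡ v (g-injective (begin
        g (flipAt j (flipAt i v))   ≡⟨ g-flipAt (flipAt i v) j ⟩
        flipAt q (g (flipAt i v))   ≡⟨ cong (flipAt q) (g-flipAt v i) ⟩
        flipAt q (flipAt p (g v))   ≡⟨ cong (λ d → flipAt q (flipAt d (g v))) p≡q ⟩
        flipAt q (flipAt q (g v))   ≡⟨ flipAt-involutive q (g v) ⟩
        g v                         ∎))))
        where open ≡-Reasoning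
  ... | inj₂ p≡s = sym p≡s
  ... | inj₁ p≡r = ⊥-elim (i≢j (flipAt-injectiveˡ v (g-injective
          (trans (g-flipAt v i) (trans (cong (λ d → flipAt d (g v)) p≡r) (sym (g-flipAt v j)))))))

  direction-constant : ∀ v w i → direction v i ≡ direction w i
  direction-constant v = flipAt-closed⇒universal (λ w → ∀ i → direction v i ≡ direction w i) step (λ i → refl)
    where
      step : ∀ u j → (∀ i → direction v i ≡ direction u i) → ∀ i → direction v i ≡ direction (flipAt j u) i
      step u j v≡u i with i ≟ j
      ... | yes refl = trans (v≡u i) (sym (direction-flipAt u i))
      ... | no  i≢j  = trans (v≡u i) (sym (direction-flipAt-≢ u i≢j))

  -- A direction of Q_{n+1} not used by g is a coordinate that g never changes.
  embedding-in-facet : ∃₂ λ k b → ∀ v → lookup (g v) k ≡ b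
  embedding-in-facet = k , lookup (g o) k , flipAt-closed⇒universal (λ v → lookup (g v) k ≡ lookup (g o) k) step refl
    where
      o : Vertex n
      o = replicate n false
      k : Fin (suc n)
      k = proj₁ (missing-value (direction o))
      step : ∀ u j → lookup (g u) k ≡ lookup (g o) k → lookup (g (flipAt j u)) k ≡ lookup (g o) k
      step u j eq = trans (cong (λ x → lookup x k) (g-flipAt u j))
        (trans (lookup-flipAt-≢ (g u) (λ d≡k → proj₂ (missing-value (direction o)) j
          (trans (direction-constant o u j) d≡k))) eq)

edge-≡ : ∀ {m} {e e′ : Edge m} → lo e ≡ lo e′ → dir e ≡ dir e′ → e ≡ e′
edge-≡ {e = edge l d p} {edge .l .d p′} refl refl = cong (edge l d) (Decidable⇒UIP.≡-irrelevant Bool._≟_ p p′)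

lo≢hi : ∀ {m} {e e′ : Edge m} → dir e ≡ dir e′ → lo e ≢ hi e′
lo≢hi {e = e} {e′} d≡d′ lo≡hi = Bool.not-¬ {false} refl (begin
  false                         ≡⟨ sym (low e) ⟩
  lookup (lo e) (dir e)         ≡⟨ cong₂ lookup lo≡hi d≡d′ ⟩
  lookup (hi e′) (dir e′)       ≡⟨ lookup-flipAt (dir e′) (lo e′) ⟩
  not (lookup (lo e′) (dir e′)) ≡⟨ cong not (low e′) ⟩
  true                          ∎)
  where open ≡-Reasoning

Incident-unique : ∀ {m} {v : Vertex m} {e e′ : Edge m} →
                  Incident v e → Incident v e′ → dir e ≡ dir e′ → e ≡ e′
Incident-unique (inj₁ refl) (inj₁ v≡lo′) d≡d′ = edge-≡ v≡lo′ d≡d′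
Incident-unique {e = e} {e′} (inj₁ refl) (inj₂ v≡hi′) d≡d′ = ⊥-elim (lo≢hi {e = e} {e′} d≡d′ v≡hi′)
Incident-unique {e = e} {e′} (inj₂ v≡hi) (inj₁ refl)  d≡d′ = ⊥-elim (lo≢hi {e = e′} {e} (sym d≡d′) v≡hi)
Incident-unique {e = e} {e′} (inj₂ refl) (inj₂ v≡hi′) d≡d′ = edge-≡ (begin
  lo e                    ≡⟨ sym (flipAt-involutive (dir e) (lo e)) ⟩
  flipAt (dir e) (hi e)   ≡⟨ cong₂ flipAt d≡d′ v≡hi′ ⟩
  flipAt (dir e′) (hi e′) ≡⟨ flipAt-involutive (dir e′) (lo e′) ⟩
  lo e′                   ∎) d≡d′
  where open ≡-Reasoning

Incident-flipAt : ∀ {m} {v : Vertex m} (e : Edge m) → Incident v e → Incident (flipAt (dir e) v) e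
Incident-flipAt e (inj₁ refl) = inj₂ refl
Incident-flipAt e (inj₂ refl) = inj₁ (flipAt-involutive (dir e) (lo e))

lowerEnd : ∀ {m} → Vertex m → Fin m → Vertex m
lowerEnd v i = if lookup v i then flipAt i v else v

lookup-lowerEnd : ∀ {m} (v : Vertex m) i → lookup (lowerEnd v i) i ≡ false
lookup-lowerEnd v i = go (lookup v i) refl
  where
    go : ∀ b → lookup v i ≡ b → lookup (if b then flipAt i v else v) i ≡ false
    go false eq = eq
    go true  eq = trans (lookup-flipAt i v) (cong not eq)

edgeAt : ∀ {m} → Vertex m → Fin m → Edge m
edgeAt v i = edge (lowerEnd v i) i (lookup-lowerEnd v i)

Incident-edgeAt : ∀ {m} (v : Vertex m) i → Incident v (edgeAt v i)
Incident-edgeAt v i = go (lookup v i)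
  where
    go : ∀ b → let u = if b then flipAt i v else v in v ≡ u ⊎ v ≡ flipAt i u
    go false = inj₁ refl
    go true  = inj₂ (sym (flipAt-involutive i v))

edgeAt-lo : ∀ {m} (e : Edge m) → edgeAt (lo e) (dir e) ≡ e
edgeAt-lo e = Incident-unique (Incident-edgeAt (lo e) (dir e)) (inj₁ refl) refl

edgeAt-flipAt : ∀ {m} (v : Vertex m) i → edgeAt (flipAt i v) i ≡ edgeAt v i
edgeAt-flipAt v i = Incident-unique
  (subst (λ x → Incident x (edgeAt (flipAt i v) i)) (flipAt-involutive i v)
    (Incident-flipAt (edgeAt (flipAt i v) i) (Incident-edgeAt (flipAt i v) i)))
  (Incident-edgeAt v i) refl

edgeColouring : ∀ {m} {A : Set} → (Vertex m → Fin m → A) → Edge m → A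
edgeColouring C e = C (lo e) (dir e)

edgeColouring-incident : ∀ {m} {A : Set} {C : Vertex m → Fin m → A} → FlipInvariant C →
                         ∀ {v e} → Incident v e → C v (dir e) ≡ edgeColouring C e
edgeColouring-incident C-flipAt (inj₁ refl) = refl
edgeColouring-incident C-flipAt {e = e} (inj₂ refl) = C-flipAt (lo e) (dir e)

Proper-edgeColouring : ∀ {m} {C : Vertex m → Fin m → Fin m} → LocallyProper C → Proper (edgeColouring C)
Proper-edgeColouring {C = C} C-proper e e′ v e≢e′ v∈e v∈e′ eq =
  e≢e′ (Incident-unique v∈e v∈e′ (injective v (trans (seen-from {e} v∈e) (trans eq (sym (seen-from {e′} v∈e′))))))
  where
    open LocallyProper C-proper
    seen-from : ∀ {e} → Incident v e → C v (dir e) ≡ edgeColouring C e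
    seen-from {e} = edgeColouring-incident {C = C} flipAt-invariant {v} {e}

lookup-removeAt : ∀ {m} (xs : Vertex (suc m)) k j → lookup (removeAt xs k) j ≡ lookup xs (punchIn k j)
lookup-removeAt (x ∷ xs)     zero    j       = refl
lookup-removeAt (x ∷ y ∷ xs) (suc k) zero    = refl
lookup-removeAt (x ∷ y ∷ xs) (suc k) (suc j) = lookup-removeAt (y ∷ xs) k j

lookup-ext : ∀ {m} {xs ys : Vertex m} → (∀ i → lookup xs i ≡ lookup ys i) → xs ≡ ys
lookup-ext {xs = xs} {ys} eq = trans (sym (tabulate∘lookup xs)) (trans (tabulate-cong eq) (tabulate∘lookup ys))

module _ {m} (k : Fin (suc m)) where

  removeAt-flipAt : ∀ v → removeAt (flipAt k v) k ≡ removeAt v k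
  removeAt-flipAt v = lookup-ext λ j → begin
    lookup (removeAt (flipAt k v) k) j ≡⟨ lookup-removeAt (flipAt k v) k j ⟩
    lookup (flipAt k v) (punchIn k j)  ≡⟨ lookup-flipAt-≢ v (punchInᵢ≢i k j ∘ sym) ⟩
    lookup v (punchIn k j)             ≡⟨ sym (lookup-removeAt v k j) ⟩
    lookup (removeAt v k) j            ∎
    where open ≡-Reasoning

  removeAt-flipAt-punchIn : ∀ j v → removeAt (flipAt (punchIn k j) v) k ≡ flipAt j (removeAt v k)
  removeAt-flipAt-punchIn j v = lookup-ext λ j′ → begin
    lookup (removeAt (flipAt (punchIn k j) v) k) j′ ≡⟨ lookup-removeAt (flipAt (punchIn k j) v) k j′ ⟩
    lookup (flipAt (punchIn k j) v) (punchIn k j′)  ≡⟨ flip-coordinate j′ ⟩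
    lookup (flipAt j (removeAt v k)) j′             ∎
    where
      open ≡-Reasoning
      flip-coordinate : ∀ j′ → lookup (flipAt (punchIn k j) v) (punchIn k j′) ≡ lookup (flipAt j (removeAt v k)) j′
      flip-coordinate j′ with j ≟ j′
      ... | yes refl = trans (lookup-flipAt (punchIn k j) v)
                         (sym (trans (lookup-flipAt j (removeAt v k)) (cong not (lookup-removeAt v k j))))
      ... | no  j≢j′ = trans (lookup-flipAt-≢ v (j≢j′ ∘ punchIn-injective k j j′))
                         (sym (trans (lookup-flipAt-≢ (removeAt v k) j≢j′) (lookup-removeAt v k j′)))

  insertAt-flipAt : ∀ j w b → insertAt (flipAt j w) k b ≡ flipAt (punchIn k j) (insertAt w k b)
  insertAt-flipAt j w b = begin
    insertAt (flipAt j w) k b                                   ≡⟨ cong₂ (λ u c → insertAt u k c) removed kept ⟩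
    insertAt (removeAt x k) k (lookup x k)                      ≡⟨ insertAt-removeAt x k ⟩
    x                                                           ∎
    where
      open ≡-Reasoning
      x : Vertex (suc m)
      x = flipAt (punchIn k j) (insertAt w k b)
      removed : flipAt j w ≡ removeAt x k
      removed = sym (trans (removeAt-flipAt-punchIn j (insertAt w k b)) (cong (flipAt j) (removeAt-insertAt w k b)))
      kept : b ≡ lookup x k
      kept = sym (trans (lookup-flipAt-≢ (insertAt w k b) (punchInᵢ≢i k j)) (insertAt-lookup w k b))

module Prism {n} (k : Fin (suc n)) (b : Bool) (φ : PartialColoring (suc n)) where

  -- φ on the facet x_k = b, read as a partial colouring of Q_n.
  Φ : Vertex n → Fin n → Maybe (Fin (suc n))
  Φ w j = φ (edgeAt (insertAt w k b) (punchIn k j))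

  Φ-flipAt : FlipInvariant Φ
  Φ-flipAt w j = cong φ (trans (cong (λ x → edgeAt x (punchIn k j)) (insertAt-flipAt k j w b))
                              (edgeAt-flipAt (insertAt w k b) (punchIn k j)))

  Φ-lo : ∀ e → lookup (lo e) k ≡ b → (k≢d : k ≢ dir e) → Φ (removeAt (lo e) k) (punchOut k≢d) ≡ φ e
  Φ-lo e lo≡b k≢d = cong φ (trans
    (cong₂ edgeAt (trans (cong (insertAt (removeAt (lo e) k) k) (sym lo≡b)) (insertAt-removeAt (lo e) k))
                  (punchIn-punchOut k≢d))
    (edgeAt-lo e))

  module _ {F : Vertex n → Fin n → Fin (suc n)} (F-proper : LocallyProper F) where
    open LocallyProper F-proper

    unused : Vertex n → Fin (suc n)
    unused w = proj₁ (missing-value (F w))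

    extend : Vertex (suc n) → Fin (suc n) → Fin (suc n)
    extend v d with k ≟ d
    ... | yes _   = unused (removeAt v k)
    ... | no  k≢d = F (removeAt v k) (punchOut k≢d)

    extend-≢ : ∀ v {d} (k≢d : k ≢ d) → extend v d ≡ F (removeAt v k) (punchOut k≢d)
    extend-≢ v {d} k≢d with k ≟ d
    ... | yes k≡d  = ⊥-elim (k≢d k≡d)
    ... | no  k≢d′ = cong (F (removeAt v k)) (punchOut-cong k refl)

    extend-flipAt : FlipInvariant extend
    extend-flipAt v d with k ≟ d
    ... | yes refl = cong unused (removeAt-flipAt k v)
    ... | no  k≢d  = trans (cong (λ w → F w (punchOut k≢d)) (begin
        removeAt (flipAt d v) k                           ≡⟨ cong (λ d → removeAt (flipAt d v) k) (sym (punchIn-punchOut k≢d)) ⟩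
        removeAt (flipAt (punchIn k (punchOut k≢d)) v) k  ≡⟨ removeAt-flipAt-punchIn k (punchOut k≢d) v ⟩
        flipAt (punchOut k≢d) (removeAt v k)              ∎))
      (flipAt-invariant (removeAt v k) (punchOut k≢d))
      where open ≡-Reasoning

    extend-injective : ∀ v {d d′} → extend v d ≡ extend v d′ → d ≡ d′
    extend-injective v {d} {d′} eq with k ≟ d | k ≟ d′
    ... | yes refl | yes refl = refl
    ... | yes refl | no  k≢d′ = ⊥-elim (proj₂ (missing-value (F (removeAt v k))) (punchOut k≢d′) (sym eq))
    ... | no  k≢d  | yes refl = ⊥-elim (proj₂ (missing-value (F (removeAt v k))) (punchOut k≢d) eq)
    ... | no  k≢d  | no  k≢d′ = punchOut-injective k≢d k≢d′ (injective (removeAt v k) eq)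

    extend-proper : LocallyProper extend
    extend-proper = record { flipAt-invariant = extend-flipAt ; injective = extend-injective }

    extend-avoids : (∀ w j → Φ w j ≢ just (F w j)) →
                    ∀ e c → φ e ≡ just c → lookup (lo e) k ≡ b → lookup (hi e) k ≡ b → edgeColouring extend e ≢ c
    extend-avoids F-avoids e c φe≡c lo≡b hi≡b extend≡c = F-avoids (removeAt (lo e) k) (punchOut k≢d)
      (trans (Φ-lo e lo≡b k≢d) (trans φe≡c (cong just (sym (trans (sym (extend-≢ (lo e) k≢d)) extend≡c)))))
      where
        k≢d : k ≢ dir e
        k≢d refl = Bool.not-¬ {b} refl (trans (sym hi≡b) (trans (lookup-flipAt k (lo e)) (cong not lo≡b)))

proposition3p9 : ∀ (n : ℕ) → 1 ≤ n →
    (φ : PartialColoring (suc n)) →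
    (g : Vertex n → Vertex (suc n)) → IsEmbedding g →
    (∀ (e : Edge (suc n)) (c : Fin (suc n)) → φ e ≡ just c → InImage g e) →
    Avoidable φ
proposition3p9 n _ φ g g-embedding φ⊆image with embedding-in-facet g-embedding
... | k , b , g-in-facet with ListColouring.colouring (Prism.Φ k b φ) (Prism.Φ-flipAt k b φ)
...   | F , F-proper , F-avoids =
  edgeColouring (extend F-proper) , Proper-edgeColouring (extend-proper F-proper) , avoids
  where
    open Prism k b φ

    avoids : ∀ e c → φ e ≡ just c → edgeColouring (extend F-proper) e ≢ c
    avoids e c φe≡c with φ⊆image e c φe≡c
    ... | a , i , lo≡ga , hi≡ga′ = extend-avoids F-proper F-avoids e c φe≡c
      (trans (cong (λ x → lookup x k) lo≡ga) (g-in-facet a))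
      (trans (cong (λ x → lookup x k) hi≡ga′) (g-in-facet (flipAt i a)))
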